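{- For every integer $k\ge 0$, as formal power series in $x$, $$\sum_{n\ge0}L(n,k)x^n=\sum_{n\ge0}L(n,n-k)x^n=\frac{x^k e_k(x)}{(1-x)^{k+1}(1+x)^k},$$ where $e_k(x)=\sum_{j=0}^k e(k,j)x^j$.
   Context: $e(n,k)$ is the number of $k$-subsets of $\{1,\dots,n\}$ whose element sum is even (the empty set counts as even). Losanitsch's triangle is defined by $L(0,k)=[k=0]$, $L(1,k)=[0\le k\le 1]$, $L(n,k)=0$ for $k<0$, and for $n\ge 2$ by $L(n,k)=L(n-2,k)+\binom{n-2}{k-1}+L(n-2,k-2)$ (with $\binom{m}{j}=0$ for $j<0$ or $j>m$); in particular $L(n,k)=0$ for $k>n$ and $L(n,n-k)=0$ for $n<k$. -}

module Defs where

open import Data.Nat as ℕ using (ℕ; zero; suc; _∸_; _≤?_; _<?_; _≟_)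
open import Data.Nat.Combinatorics using (_C_)
open import Data.Integer as ℤ using (ℤ; +_; -[1+_]; _+_; _*_; _-_; -_)
open import Data.List using (List; []; _∷_; _++_; map; filter; length)
open import Data.Nat.ListAction using (sum)
open import Data.Product using (_×_)
open import Data.Bool using (true; false)
open import Relation.Nullary using (yes; no)
open import Relation.Nullary.Decidable using (_×-dec_)
open import Relation.Binary.PropositionalEquality using (_≡_)

-- all subsets of {1,…,n}, each as a list of its (distinct) elements
subsets : ℕ → List (List ℕ)
subsets zero    = [] ∷ []
subsets (suc n) = subsets n ++ map (suc n ∷_) (subsets n)

e : ℕ → ℕ → ℕ
e n k = length (filter (λ s → (length s ≟ k) ×-dec (sum s ℕ.% 2 ≟ 0)) (subsets n))

-- binomial coefficient with integer lower index (0 for negative index;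
-- stdlib's _C_ is 0 when the lower index exceeds the upper one)
binomℤ : ℕ → ℤ → ℕ
binomℤ m (+ j)    = m C j
binomℤ m -[1+ _ ] = 0

L : ℕ → ℤ → ℕ
L zero (+ zero)          = 1
L zero _                 = 0
L (suc zero) (+ zero)    = 1
L (suc zero) (+ suc zero) = 1
L (suc zero) _           = 0
L (suc (suc n)) k = L n k ℕ.+ binomℤ n (k - + 1) ℕ.+ L n (k - + 2)

Series : Set
Series = ℕ → ℤ

_≗ₛ_ : Series → Series → Set
f ≗ₛ g = ∀ n → f n ≡ g n

sumUpTo : ℕ → (ℕ → ℤ) → ℤ
sumUpTo zero    f = f zero
sumUpTo (suc n) f = sumUpTo n f + f (suc n)

_⋆_ : Series → Series → Series
(f ⋆ g) n = sumUpTo n (λ i → f i * g (n ∸ i))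

one : Series
one zero    = + 1
one (suc _) = + 0

_^ₛ_ : Series → ℕ → Series
f ^ₛ zero  = one
f ^ₛ suc m = f ⋆ (f ^ₛ m)

oneMinusX : Series
oneMinusX zero          = + 1
oneMinusX (suc zero)    = - (+ 1)
oneMinusX (suc (suc _)) = + 0

onePlusX : Series
onePlusX zero          = + 1
onePlusX (suc zero)    = + 1
onePlusX (suc (suc _)) = + 0

shift : ℕ → Series → Series
shift k f n with n ℕ.<? k
... | yes _ = + 0
... | no  _ = f (n ∸ k)

ePoly : ℕ → Series
ePoly k j with j ≤? k
... | yes _ = + e k j
... | no  _ = + 0

numer : ℕ → Series
numer k = shift k (ePoly k)

denom : ℕ → Series
denom k = (oneMinusX ^ₛ suc k) ⋆ (onePlusX ^ₛ k)

LColumn : ℕ → Series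
LColumn k n = + L n (+ k)

LDiagonal : ℕ → Series
LDiagonal k n = + L n (+ n - + k)

module Submission where

-- Write F_k = Σₙ L(n,k) xⁿ, G_j = Σₙ C(n,j) xⁿ, A = 1 - x, B = 1 + x.
-- The defining recurrence L(n+2,k+2) = L(n,k+2) + C(n,k+1) + L(n,k) says
-- F_{k+2} = x²(G_{k+1} + F_k) + x² F_{k+2}, i.e. (1-x²) F_{k+2} = x²(G_{k+1} + F_k)
-- (column 1 is the special case (1-x²) F₁ = x G₀).  Pascal's rule gives
-- A^{j+1} G_j = x^j, and counting subsets of {1,…,k+2} by whether they
-- contain k+1 and k+2 gives (1-x²) e_k(x) + x B^{k+1} = e_{k+2}(x).
-- Multiplying by denom (k+2) = (1-x²)² · denom k, these three facts turn
-- denom k · F_k = x^k e_k(x) into the same statement for k+2, so induction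
-- from k = 0, 1 proves the column identity; symmetry L(n,k) = L(n,n-k)
-- identifies column and diagonal.

open import Defs
open import Data.Nat as ℕ using (ℕ; zero; suc; _∸_)
import Data.Nat.Properties as ℕP
import Data.Nat.Tactic.RingSolver as ℕSolver
open import Data.Nat.Combinatorics using (_C_; nCk+nC[k+1]≡[n+1]C[k+1]; nCk≡nC[n∸k]; k>n⇒nCk≡0)
open import Data.Product using (_×_; _,_)
open import Level using (0ℓ)
open import Relation.Nullary using (yes; no)
open import Relation.Binary.PropositionalEquality
  using (_≡_; refl; sym; trans; cong; cong₂; module ≡-Reasoning)

module EvenSubsets where
  open import Data.Nat using (_+_; _*_; _%_; _≟_; _<_; s≤s)
  open import Data.Nat.DivMod using (%-distribˡ-+; [m+kn]%n≡m%n)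
  open import Data.Nat.ListAction using (sum)
  open import Data.List using (List; []; _∷_; _++_; map; filter; length)
  open import Data.List.Properties using (length-++; filter-++; filter-≐; filter-none)
  open import Data.List.Relation.Unary.All using (universal)
  open import Relation.Nullary.Decidable using (_×-dec_)
  open import Relation.Unary using (Pred; Decidable)
  open import Algebra.Properties.CommutativeSemigroup ℕP.+-commutativeSemigroup using (interchange)
  open ℕSolver using (solve-∀)

  count : {A : Set} {P : Pred A 0ℓ} → Decidable P → List A → ℕ
  count P? xs = length (filter P? xs)

  count-++ : ∀ {A : Set} {P : Pred A 0ℓ} (P? : Decidable P) xs ys →
    count P? (xs ++ ys) ≡ count P? xs + count P? ys
  count-++ P? xs ys = trans (cong length (filter-++ P? xs ys)) (length-++ (filter P? xs))

  count-map : ∀ {A B : Set} {P : Pred B 0ℓ} (P? : Decidable P) (f : A → B) xs →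
    count P? (map f xs) ≡ count {P = λ x → P (f x)} (λ x → P? (f x)) xs
  count-map P? f []       = refl
  count-map P? f (x ∷ xs) with P? (f x)
  ... | yes _ = cong suc (count-map P? f xs)
  ... | no  _ = count-map P? f xs

  -- Mod 2, a + b ≡ p exactly when b ≡ p + a (as -a ≡ a): one direction each.
  parity-shift : ∀ a b p → (a + b) % 2 ≡ p % 2 → b % 2 ≡ (p + a) % 2
  parity-shift a b p a+b≡p = begin
    b % 2                      ≡⟨ [m+kn]%n≡m%n b a 2 ⟨
    (b + a * 2) % 2            ≡⟨ cong (_% 2) (double a b) ⟩
    ((a + b) + a) % 2          ≡⟨ %-distribˡ-+ (a + b) a 2 ⟩
    ((a + b) % 2 + a % 2) % 2  ≡⟨ cong (λ r → (r + a % 2) % 2) a+b≡p ⟩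
    (p % 2 + a % 2) % 2        ≡⟨ %-distribˡ-+ p a 2 ⟨
    (p + a) % 2                ∎ where
    open ≡-Reasoning
    double : ∀ a b → b + a * 2 ≡ (a + b) + a
    double = solve-∀

  parity-unshift : ∀ a b p → b % 2 ≡ (p + a) % 2 → (a + b) % 2 ≡ p % 2
  parity-unshift a b p b≡p+a = begin
    (a + b) % 2                  ≡⟨ %-distribˡ-+ a b 2 ⟩
    (a % 2 + b % 2) % 2          ≡⟨ cong (λ r → (a % 2 + r) % 2) b≡p+a ⟩
    (a % 2 + (p + a) % 2) % 2    ≡⟨ %-distribˡ-+ a (p + a) 2 ⟨
    (a + (p + a)) % 2            ≡⟨ cong (_% 2) (double a p) ⟩
    (p + a * 2) % 2              ≡⟨ [m+kn]%n≡m%n p a 2 ⟩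
    p % 2                        ∎ where
    open ≡-Reasoning
    double : ∀ a p → a + (p + a) ≡ p + a * 2
    double = solve-∀

  HasSizeParity : ℕ → ℕ → Pred (List ℕ) 0ℓ
  HasSizeParity j p s = length s ≡ j × sum s % 2 ≡ p % 2

  hasSizeParity? : ∀ j p → Decidable (HasSizeParity j p)
  hasSizeParity? j p s = (length s ≟ j) ×-dec (sum s % 2 ≟ p % 2)

  -- The number of j-subsets of {1,…,n} whose element sum is ≡ p (mod 2);
  -- e n j is, by definition, subsetCount n j 0.
  subsetCount : ℕ → ℕ → ℕ → ℕ
  subsetCount n j p = count (hasSizeParity? j p) (subsets n)

  subsetCount-parity : ∀ n j {p q} → p % 2 ≡ q % 2 → subsetCount n j p ≡ subsetCount n j q
  subsetCount-parity n j p≡q = cong (λ r → count (λ s → (length s ≟ j) ×-dec (sum s % 2 ≟ r)) (subsets n)) p≡q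

  -- A subset of {1,…,n+1} either avoids n+1, or is {n+1} ∪ s with s ⊆ {1,…,n};
  -- in the latter case its size and sum exceed those of s by 1 and n+1.
  subsetCount-suc₀ : ∀ n p → subsetCount (suc n) 0 p ≡ subsetCount n 0 p
  subsetCount-suc₀ n p = begin
    subsetCount (suc n) 0 p
      ≡⟨ count-++ (hasSizeParity? 0 p) (subsets n) (map (suc n ∷_) (subsets n)) ⟩
    subsetCount n 0 p + count (hasSizeParity? 0 p) (map (suc n ∷_) (subsets n))
      ≡⟨ cong (subsetCount n 0 p +_) (trans (count-map (hasSizeParity? 0 p) (suc n ∷_) (subsets n))
           (cong length (filter-none (λ s → hasSizeParity? 0 p (suc n ∷ s)) (universal (λ { _ (() , _) }) (subsets n))))) ⟩
    subsetCount n 0 p + 0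
      ≡⟨ ℕP.+-identityʳ _ ⟩
    subsetCount n 0 p
      ∎ where open ≡-Reasoning

  -- A subset of size j+1 containing n+1 has sum ≡ p iff the rest has sum ≡ p + (n+1).
  subsetCount-suc : ∀ n j p →
    subsetCount (suc n) (suc j) p ≡ subsetCount n (suc j) p + subsetCount n j (p + suc n)
  subsetCount-suc n j p = trans (count-++ (hasSizeParity? (suc j) p) (subsets n) (map (suc n ∷_) (subsets n)))
    (cong (subsetCount n (suc j) p +_) (trans (count-map (hasSizeParity? (suc j) p) (suc n ∷_) (subsets n))
      (cong length (filter-≐ (λ s → hasSizeParity? (suc j) p (suc n ∷ s)) (hasSizeParity? j (p + suc n))
         ((λ {s} → remove-n+1 {s}) , (λ {s} → add-n+1 {s})) (subsets n)))))
    where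
    remove-n+1 : ∀ {s} → HasSizeParity (suc j) p (suc n ∷ s) → HasSizeParity j (p + suc n) s
    remove-n+1 {s} (len , par) = ℕP.suc-injective len , parity-shift (suc n) (sum s) p par
    add-n+1 : ∀ {s} → HasSizeParity j (p + suc n) s → HasSizeParity (suc j) p (suc n ∷ s)
    add-n+1 {s} (len , par) = cong suc len , parity-unshift (suc n) (sum s) p par

  subsetCount-complement : ∀ n j a → subsetCount n j a + subsetCount n j (suc a) ≡ n C j
  subsetCount-complement zero    zero    zero          = refl
  subsetCount-complement zero    zero    (suc zero)    = refl
  subsetCount-complement zero    zero    (suc (suc a)) = subsetCount-complement zero zero a
  subsetCount-complement zero    (suc j) a             = refl
  subsetCount-complement (suc n) zero    a             =
    trans (cong₂ _+_ (subsetCount-suc₀ n a) (subsetCount-suc₀ n (suc a))) (subsetCount-complement n zero a)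
  subsetCount-complement (suc n) (suc j) a = begin
    subsetCount (suc n) (suc j) a + subsetCount (suc n) (suc j) (suc a)
      ≡⟨ cong₂ _+_ (subsetCount-suc n j a) (subsetCount-suc n j (suc a)) ⟩
    (subsetCount n (suc j) a + subsetCount n j (a + suc n))
      + (subsetCount n (suc j) (suc a) + subsetCount n j (suc a + suc n))
      ≡⟨ interchange (subsetCount n (suc j) a) _ _ _ ⟩
    (subsetCount n (suc j) a + subsetCount n (suc j) (suc a))
      + (subsetCount n j (a + suc n) + subsetCount n j (suc (a + suc n)))
      ≡⟨ cong₂ _+_ (subsetCount-complement n (suc j) a) (subsetCount-complement n j (a + suc n)) ⟩
    n C suc j + n C j
      ≡⟨ trans (ℕP.+-comm (n C suc j) (n C j)) (nCk+nC[k+1]≡[n+1]C[k+1] n j) ⟩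
    suc n C suc j
      ∎ where open ≡-Reasoning

  subsetCount-above : ∀ {n j} p → n < j → subsetCount n j p ≡ 0
  subsetCount-above {zero}  {suc j} p _           = refl
  subsetCount-above {suc n} {suc j} p (s≤s n<j) = trans (subsetCount-suc n j p)
    (cong₂ _+_ (subsetCount-above p (ℕP.m<n⇒m<1+n n<j)) (subsetCount-above (p + suc n) n<j))

  e-zero : ∀ n → e n 0 ≡ 1
  e-zero zero    = refl
  e-zero (suc n) = trans (subsetCount-suc₀ n 0) (e-zero n)

  e-above : ∀ {n j} → n < j → e n j ≡ 0
  e-above = subsetCount-above 0

  -- Splitting off both k+1 and k+2 (whose sum 2k+3 is odd) gives the
  -- recurrences e(k+2,1) = C(k+1,0) + e(k,1) ...
  e-recurrence₁ : ∀ k → e (suc (suc k)) 1 ≡ suc k C 0 + e k 1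
  e-recurrence₁ k = begin
    subsetCount (suc (suc k)) 1 0
      ≡⟨ subsetCount-suc (suc k) 0 0 ⟩
    subsetCount (suc k) 1 0 + subsetCount (suc k) 0 (suc (suc k))
      ≡⟨ cong₂ _+_ (subsetCount-suc k 0 0) (subsetCount-suc₀ k (suc (suc k))) ⟩
    (subsetCount k 1 0 + subsetCount k 0 (suc k)) + subsetCount k 0 (suc (suc k))
      ≡⟨ ℕP.+-assoc (subsetCount k 1 0) _ _ ⟩
    subsetCount k 1 0 + (subsetCount k 0 (suc k) + subsetCount k 0 (suc (suc k)))
      ≡⟨ cong (subsetCount k 1 0 +_) (subsetCount-complement k 0 (suc k)) ⟩
    subsetCount k 1 0 + 1
      ≡⟨ ℕP.+-comm (subsetCount k 1 0) 1 ⟩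
    1 + subsetCount k 1 0
      ∎ where open ≡-Reasoning

  e-recurrence : ∀ k m → e (suc (suc k)) (suc (suc m)) + e k m ≡ suc k C suc m + e k (suc (suc m))
  e-recurrence k m = begin
    subsetCount (suc (suc k)) (suc (suc m)) 0 + Z
      ≡⟨ cong (_+ Z) (subsetCount-suc (suc k) (suc m) 0) ⟩
    (subsetCount (suc k) (suc (suc m)) 0 + subsetCount (suc k) (suc m) (suc (suc k))) + Z
      ≡⟨ cong (_+ Z) (cong₂ _+_ (subsetCount-suc k (suc m) 0) (subsetCount-suc k m (suc (suc k)))) ⟩
    ((E + P) + (Q + subsetCount k m (suc (suc k) + suc k))) + Z
      ≡⟨ cong (λ o → ((E + P) + (Q + o)) + Z) (subsetCount-parity k m {suc (suc k) + suc k} {1} (odd k)) ⟩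
    ((E + P) + (Q + O)) + Z
      ≡⟨ regroup E P Q O Z ⟩
    ((P + Q) + (Z + O)) + E
      ≡⟨ cong (_+ E) (cong₂ _+_ (subsetCount-complement k (suc m) (suc k)) (subsetCount-complement k m 0)) ⟩
    (k C suc m + k C m) + E
      ≡⟨ cong (_+ E) (trans (ℕP.+-comm (k C suc m) (k C m)) (nCk+nC[k+1]≡[n+1]C[k+1] k m)) ⟩
    suc k C suc m + E
      ∎ where
    open ≡-Reasoning
    E P Q O Z : ℕ
    E = subsetCount k (suc (suc m)) 0
    P = subsetCount k (suc m) (suc k)
    Q = subsetCount k (suc m) (suc (suc k))
    O = subsetCount k m 1
    Z = subsetCount k m 0
    regroup : ∀ e p q o z → ((e + p) + (q + o)) + z ≡ ((p + q) + (z + o)) + e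
    regroup = solve-∀
    odd : ∀ k → (suc (suc k) + suc k) % 2 ≡ 1 % 2
    odd k = trans (cong (_% 2) (twice k)) ([m+kn]%n≡m%n 1 (suc k) 2) where
      twice : ∀ k → suc (suc k) + suc k ≡ 1 + suc k * 2
      twice = solve-∀

open EvenSubsets using (e-zero; e-above; e-recurrence₁; e-recurrence)

-- From here on, + and * are integer operations; series have ℤ coefficients.
open import Data.Integer using (ℤ; +_; -[1+_]; _+_; _*_; _-_; -_)
import Data.Integer.Properties as ℤP
open import Data.Integer.Tactic.RingSolver using (solve-∀)
open import Algebra.Bundles using (CommutativeSemiring)
open import Algebra.Structures.Biased using (isCommutativeSemiringˡ)
open import Algebra.Properties.CommutativeSemigroup ℤP.+-commutativeSemigroup
  using () renaming (interchange to +-interchange)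
open import Algebra.Properties.AbelianGroup ℤP.+-0-abelianGroup
  using () renaming (∙-cancelʳ to +-cancelʳ)
open import Relation.Binary.Structures using (IsEquivalence)
import Relation.Binary.Reasoning.Setoid as SetoidReasoning

L-negative : ∀ n m → L n -[1+ m ] ≡ 0
L-negative zero          m = refl
L-negative (suc zero)    m = refl
L-negative (suc (suc n)) m = cong₂ (λ a b → a ℕ.+ 0 ℕ.+ b) (L-negative n m) (L-negative n (suc (m ℕ.+ 1)))

L-zero : ∀ n → L n (+ 0) ≡ 1
L-zero zero          = refl
L-zero (suc zero)    = refl
L-zero (suc (suc n)) = cong₂ (λ a b → a ℕ.+ 0 ℕ.+ b) (L-zero n) (L-negative n 1)

binomℤ-symmetric : ∀ n w → binomℤ n w ≡ binomℤ n (+ n - w)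
binomℤ-symmetric n (+ j) with j ℕP.≤? n
... | yes j≤n = trans (nCk≡nC[n∸k] j≤n) (cong (binomℤ n) (sym (trans (ℤP.m-n≡m⊖n n j) (ℤP.⊖-≥ j≤n))))
... | no  j≰n = trans (k>n⇒nCk≡0 n<j) (sym (trans (cong (binomℤ n) (trans (ℤP.m-n≡m⊖n n j) (ℤP.⊖-< n<j)))
                  (binomℤ-negative (j ∸ n) (ℕP.m<n⇒0<n∸m n<j))))
  where
  n<j : n ℕ.< j
  n<j = ℕP.≰⇒> j≰n
  binomℤ-negative : ∀ t → 0 ℕ.< t → binomℤ n (- + t) ≡ 0
  binomℤ-negative (suc t) _ = refl
binomℤ-symmetric n -[1+ m ] = sym (k>n⇒nCk≡0 (ℕP.m<m+n n (ℕ.s≤s ℕ.z≤n)))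

-- Symmetry of Losanitsch's triangle: L(n,k) = L(n,n-k).  The recurrence is
-- mapped to itself by k ↦ n - k, with its two outer terms exchanged.
L-symmetric : ∀ n z → L n z ≡ L n (+ n - z)
L-symmetric zero          (+ zero)         = refl
L-symmetric zero          (+ suc _)        = refl
L-symmetric zero          -[1+ _ ]         = refl
L-symmetric (suc zero)    (+ zero)         = refl
L-symmetric (suc zero)    (+ suc zero)     = refl
L-symmetric (suc zero)    (+ suc (suc _))  = refl
L-symmetric (suc zero)    -[1+ _ ]         = refl
L-symmetric (suc (suc n)) z = begin
  L n z ℕ.+ binomℤ n (z - + 1) ℕ.+ L n (z - + 2)
    ≡⟨ cong₂ ℕ._+_ (cong₂ ℕ._+_ (trans (L-symmetric n z) (cong (L n) (reindex₂ (+ n) z)))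
                                 (trans (binomℤ-symmetric n (z - + 1)) (cong (binomℤ n) (reindex₁ (+ n) z))))
                    (trans (L-symmetric n (z - + 2)) (cong (L n) (reindex₀ (+ n) z))) ⟩
  L n (w - + 2) ℕ.+ binomℤ n (w - + 1) ℕ.+ L n w
    ≡⟨ swap-outer (L n (w - + 2)) (binomℤ n (w - + 1)) (L n w) ⟩
  L (suc (suc n)) (+ (n ℕ.+ 2) - z)
    ≡⟨ cong (λ m → L (suc (suc n)) (+ m - z)) (ℕP.+-comm n 2) ⟩
  L (suc (suc n)) (+ suc (suc n) - z)
    ∎ where
  open ≡-Reasoning
  w : ℤ
  w = + n + + 2 - z
  reindex₂ : ∀ a z → a - z ≡ (a + + 2 - z) - + 2
  reindex₂ = solve-∀
  reindex₁ : ∀ a z → a - (z - + 1) ≡ (a + + 2 - z) - + 1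
  reindex₁ = solve-∀
  reindex₀ : ∀ a z → a - (z - + 2) ≡ a + + 2 - z
  reindex₀ = solve-∀
  swap-outer : ∀ a b c → a ℕ.+ b ℕ.+ c ≡ c ℕ.+ b ℕ.+ a
  swap-outer = ℕSolver.solve-∀

sum-cong : ∀ n {f g : ℕ → ℤ} → (∀ i → i ℕ.≤ n → f i ≡ g i) → sumUpTo n f ≡ sumUpTo n g
sum-cong zero    f≡g = f≡g 0 ℕ.z≤n
sum-cong (suc n) f≡g =
  cong₂ _+_ (sum-cong n (λ i i≤n → f≡g i (ℕP.m≤n⇒m≤1+n i≤n))) (f≡g (suc n) ℕP.≤-refl)

sum-+ : ∀ n (f g : ℕ → ℤ) → sumUpTo n (λ i → f i + g i) ≡ sumUpTo n f + sumUpTo n g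
sum-+ zero    f g = refl
sum-+ (suc n) f g = begin
  sumUpTo n (λ i → f i + g i) + (f (suc n) + g (suc n))
    ≡⟨ cong (_+ (f (suc n) + g (suc n))) (sum-+ n f g) ⟩
  (sumUpTo n f + sumUpTo n g) + (f (suc n) + g (suc n))
    ≡⟨ +-interchange (sumUpTo n f) (sumUpTo n g) (f (suc n)) (g (suc n)) ⟩
  (sumUpTo n f + f (suc n)) + (sumUpTo n g + g (suc n))
    ∎ where open ≡-Reasoning

sum-*ˡ : ∀ n c (f : ℕ → ℤ) → sumUpTo n (λ i → c * f i) ≡ c * sumUpTo n f
sum-*ˡ zero    c f = refl
sum-*ˡ (suc n) c f = trans (cong (_+ c * f (suc n)) (sum-*ˡ n c f))
  (sym (ℤP.*-distribˡ-+ c (sumUpTo n f) (f (suc n))))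

sum-suc : ∀ n (f : ℕ → ℤ) → sumUpTo (suc n) f ≡ f 0 + sumUpTo n (λ i → f (suc i))
sum-suc zero    f = refl
sum-suc (suc n) f = trans (cong (_+ f (suc (suc n))) (sum-suc n f)) (ℤP.+-assoc (f 0) _ _)

sum-reverse : ∀ n (f : ℕ → ℤ) → sumUpTo n f ≡ sumUpTo n (λ i → f (n ∸ i))
sum-reverse zero    f = refl
sum-reverse (suc n) f = begin
  sumUpTo n f + f (suc n)                          ≡⟨ cong (_+ f (suc n)) (sum-reverse n f) ⟩
  sumUpTo n (λ i → f (n ∸ i)) + f (suc n)          ≡⟨ ℤP.+-comm _ (f (suc n)) ⟩
  f (suc n) + sumUpTo n (λ i → f (suc n ∸ suc i))  ≡⟨ sum-suc n (λ i → f (suc n ∸ i)) ⟨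
  sumUpTo (suc n) (λ i → f (suc n ∸ i))            ∎ where open ≡-Reasoning

infixl 6 _+ₛ_
_+ₛ_ : Series → Series → Series
(f +ₛ g) n = f n + g n

0ₛ : Series
0ₛ _ = + 0

_·ₛ_ : ℤ → Series → Series
(c ·ₛ f) n = c * f n

tail : Series → Series
tail f n = f (suc n)

⋆-cong : ∀ {f f′ g g′} → f ≗ₛ f′ → g ≗ₛ g′ → (f ⋆ g) ≗ₛ (f′ ⋆ g′)
⋆-cong f≗f′ g≗g′ n = sum-cong n (λ i _ → cong₂ _*_ (f≗f′ i) (g≗g′ (n ∸ i)))

⋆-congˡ : ∀ {f f′} g → f ≗ₛ f′ → (f ⋆ g) ≗ₛ (f′ ⋆ g)
⋆-congˡ {f} {f′} g f≗f′ = ⋆-cong {f} {f′} {g} {g} f≗f′ (λ _ → refl)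

⋆-congʳ : ∀ f {g g′} → g ≗ₛ g′ → (f ⋆ g) ≗ₛ (f ⋆ g′)
⋆-congʳ f {g} {g′} g≗g′ = ⋆-cong {f} {f} {g} {g′} (λ _ → refl) g≗g′

⋆-suc : ∀ f g n → (f ⋆ g) (suc n) ≡ f 0 * g (suc n) + (tail f ⋆ g) n
⋆-suc f g n = sum-suc n (λ i → f i * g (suc n ∸ i))

⋆-distribʳ : ∀ h f g → ((f +ₛ g) ⋆ h) ≗ₛ ((f ⋆ h) +ₛ (g ⋆ h))
⋆-distribʳ h f g n = trans (sum-cong n (λ i _ → ℤP.*-distribʳ-+ (h (n ∸ i)) (f i) (g i)))
  (sum-+ n (λ i → f i * h (n ∸ i)) (λ i → g i * h (n ∸ i)))

⋆-·ˡ : ∀ c f g → ((c ·ₛ f) ⋆ g) ≗ₛ (c ·ₛ (f ⋆ g))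
⋆-·ˡ c f g n = trans (sum-cong n (λ i _ → ℤP.*-assoc c (f i) (g (n ∸ i))))
  (sum-*ˡ n c (λ i → f i * g (n ∸ i)))

⋆-zeroˡ : ∀ f → (0ₛ ⋆ f) ≗ₛ 0ₛ
⋆-zeroˡ f n = trans (sum-*ˡ n (+ 0) (λ i → f (n ∸ i))) (ℤP.*-zeroˡ (sumUpTo n (λ i → f (n ∸ i))))

⋆-identityˡ : ∀ f → (one ⋆ f) ≗ₛ f
⋆-identityˡ f zero    = ℤP.*-identityˡ (f 0)
⋆-identityˡ f (suc n) = begin
  (one ⋆ f) (suc n)                ≡⟨ ⋆-suc one f n ⟩
  + 1 * f (suc n) + (0ₛ ⋆ f) n     ≡⟨ cong₂ _+_ (ℤP.*-identityˡ (f (suc n))) (⋆-zeroˡ f n) ⟩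
  f (suc n) + + 0                  ≡⟨ ℤP.+-identityʳ (f (suc n)) ⟩
  f (suc n)                        ∎ where open ≡-Reasoning

-- Commutativity: reverse the order of summation.
⋆-comm : ∀ f g → (f ⋆ g) ≗ₛ (g ⋆ f)
⋆-comm f g n = trans (sum-reverse n _) (sum-cong n λ i i≤n →
  trans (cong (f (n ∸ i) *_) (cong g (ℕP.m∸[m∸n]≡n i≤n))) (ℤP.*-comm (f (n ∸ i)) (g i)))

⋆-assoc : ∀ f g h → ((f ⋆ g) ⋆ h) ≗ₛ (f ⋆ (g ⋆ h))
⋆-assoc f g h zero    = ℤP.*-assoc (f 0) (g 0) (h 0)
⋆-assoc f g h (suc n) = begin
  ((f ⋆ g) ⋆ h) (suc n)
    ≡⟨ ⋆-suc (f ⋆ g) h n ⟩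
  f 0 * g 0 * h (suc n) + (tail (f ⋆ g) ⋆ h) n
    ≡⟨ cong (λ t → head + t) (⋆-congˡ {f′ = (f 0 ·ₛ tail g) +ₛ (tail f ⋆ g)} h (⋆-suc f g) n) ⟩
  f 0 * g 0 * h (suc n) + (((f 0 ·ₛ tail g) +ₛ (tail f ⋆ g)) ⋆ h) n
    ≡⟨ cong (λ t → head + t) (⋆-distribʳ h (f 0 ·ₛ tail g) (tail f ⋆ g) n) ⟩
  f 0 * g 0 * h (suc n) + (((f 0 ·ₛ tail g) ⋆ h) n + ((tail f ⋆ g) ⋆ h) n)
    ≡⟨ cong (λ t → head + t) (cong₂ _+_ (⋆-·ˡ (f 0) (tail g) h n) (⋆-assoc (tail f) g h n)) ⟩
  f 0 * g 0 * h (suc n) + (f 0 * (tail g ⋆ h) n + (tail f ⋆ (g ⋆ h)) n)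
    ≡⟨ regroup (f 0) (g 0) (h (suc n)) _ _ ⟩
  f 0 * (g 0 * h (suc n) + (tail g ⋆ h) n) + (tail f ⋆ (g ⋆ h)) n
    ≡⟨ cong (λ t → f 0 * t + (tail f ⋆ (g ⋆ h)) n) (⋆-suc g h n) ⟨
  f 0 * (g ⋆ h) (suc n) + (tail f ⋆ (g ⋆ h)) n
    ≡⟨ ⋆-suc f (g ⋆ h) n ⟨
  (f ⋆ (g ⋆ h)) (suc n)
    ∎ where
  open ≡-Reasoning
  head : ℤ
  head = f 0 * g 0 * h (suc n)
  regroup : ∀ a b c d e → a * b * c + (a * d + e) ≡ a * (b * c + d) + e
  regroup = solve-∀

seriesSemiring : CommutativeSemiring 0ℓ 0ℓ
seriesSemiring = record
  { Carrier = Series ; _≈_ = _≗ₛ_ ; _+_ = _+ₛ_ ; _*_ = _⋆_ ; 0# = 0ₛ ; 1# = one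
  ; isCommutativeSemiring = isCommutativeSemiringˡ record
    { +-isCommutativeMonoid = record
      { isMonoid = record
        { isSemigroup = record
          { isMagma = record { isEquivalence = ≗ₛ-isEquivalence ; ∙-cong = λ p q n → cong₂ _+_ (p n) (q n) }
          ; assoc = λ f g h n → ℤP.+-assoc (f n) (g n) (h n) }
        ; identity = (λ f n → ℤP.+-identityˡ (f n)) , (λ f n → ℤP.+-identityʳ (f n)) }
      ; comm = λ f g n → ℤP.+-comm (f n) (g n) }
    ; *-isCommutativeMonoid = record
      { isMonoid = record
        { isSemigroup = record
          { isMagma = record { isEquivalence = ≗ₛ-isEquivalence ; ∙-cong = ⋆-cong }
          ; assoc = ⋆-assoc }
        ; identity = ⋆-identityˡ , (λ f n → trans (⋆-comm f one n) (⋆-identityˡ f n)) }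
      ; comm = ⋆-comm }
    ; distribʳ = ⋆-distribʳ
    ; zeroˡ = ⋆-zeroˡ } }
  where
  ≗ₛ-isEquivalence : IsEquivalence _≗ₛ_
  ≗ₛ-isEquivalence = record { refl = λ _ → refl ; sym = λ p n → sym (p n) ; trans = λ p q n → trans (p n) (q n) }

X : Series
X zero          = + 0
X (suc zero)    = + 1
X (suc (suc _)) = + 0

X⋆-suc : ∀ f n → (X ⋆ f) (suc n) ≡ f n
X⋆-suc f n = begin
  (X ⋆ f) (suc n)               ≡⟨ ⋆-suc X f n ⟩
  + 0 + (tail X ⋆ f) n          ≡⟨ ℤP.+-identityˡ _ ⟩
  (tail X ⋆ f) n                ≡⟨ ⋆-congˡ f tail-X n ⟩
  (one ⋆ f) n                   ≡⟨ ⋆-identityˡ f n ⟩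
  f n                           ∎ where
  open ≡-Reasoning
  tail-X : tail X ≗ₛ one
  tail-X zero    = refl
  tail-X (suc _) = refl

X⋆tail : ∀ f → f 0 ≡ + 0 → f ≗ₛ (X ⋆ tail f)
X⋆tail f f₀≡0 zero    = f₀≡0
X⋆tail f _    (suc n) = sym (X⋆-suc (tail f) n)

Xpow⋆-below : ∀ k f {n} → n ℕ.< k → ((X ^ₛ k) ⋆ f) n ≡ + 0
Xpow⋆-below (suc k) f {zero}  _             = ⋆-assoc X (X ^ₛ k) f 0
Xpow⋆-below (suc k) f {suc n} (ℕ.s≤s n<k) =
  trans (⋆-assoc X (X ^ₛ k) f (suc n)) (trans (X⋆-suc ((X ^ₛ k) ⋆ f) n) (Xpow⋆-below k f n<k))

Xpow⋆-above : ∀ k f {n} → k ℕ.≤ n → ((X ^ₛ k) ⋆ f) n ≡ f (n ∸ k)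
Xpow⋆-above zero    f {n}     _             = ⋆-identityˡ f n
Xpow⋆-above (suc k) f {suc n} (ℕ.s≤s k≤n) =
  trans (⋆-assoc X (X ^ₛ k) f (suc n)) (trans (X⋆-suc ((X ^ₛ k) ⋆ f) n) (Xpow⋆-above k f k≤n))

shift≗Xpow⋆ : ∀ k f → shift k f ≗ₛ ((X ^ₛ k) ⋆ f)
shift≗Xpow⋆ k f n with n ℕ.<? k
... | yes n<k = sym (Xpow⋆-below k f n<k)
... | no  n≮k = sym (Xpow⋆-above k f (ℕP.≮⇒≥ n≮k))

open CommutativeSemiring seriesSemiring using (setoid; +-cong)
  renaming (trans to ≗ₛ-trans; sym to ≗ₛ-sym)
module ≈-Reasoning = SetoidReasoning setoid
open import Algebra.Solver.Ring.NaturalCoefficients.Default seriesSemiring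

+ₛ-cancelʳ : ∀ {f g} h → (f +ₛ h) ≗ₛ (g +ₛ h) → f ≗ₛ g
+ₛ-cancelʳ {f} {g} h eq n = +-cancelʳ (h n) (f n) (g n) (eq n)

onePlusX-⋆ : ∀ f → (onePlusX ⋆ f) ≗ₛ (f +ₛ X ⋆ f)
onePlusX-⋆ f = begin
  onePlusX ⋆ f        ≈⟨ ⋆-congˡ f onePlusX≗ ⟩
  (one +ₛ X) ⋆ f      ≈⟨ solve 2 (λ x f → (con 1 :+ x) :* f := f :+ x :* f) (λ _ → refl) X f ⟩
  f +ₛ X ⋆ f          ∎ where
  open ≈-Reasoning
  onePlusX≗ : onePlusX ≗ₛ (one +ₛ X)
  onePlusX≗ zero          = refl
  onePlusX≗ (suc zero)    = refl
  onePlusX≗ (suc (suc _)) = refl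

oneMinusX-⋆ : ∀ f → ((oneMinusX ⋆ f) +ₛ X ⋆ f) ≗ₛ f
oneMinusX-⋆ f = begin
  (oneMinusX ⋆ f) +ₛ X ⋆ f  ≈⟨ solve 3 (λ a x f → a :* f :+ x :* f := (a :+ x) :* f) (λ _ → refl) oneMinusX X f ⟩
  (oneMinusX +ₛ X) ⋆ f      ≈⟨ ⋆-congˡ f oneMinusX+X ⟩
  one ⋆ f                   ≈⟨ ⋆-identityˡ f ⟩
  f                         ∎ where
  open ≈-Reasoning
  oneMinusX+X : (oneMinusX +ₛ X) ≗ₛ one
  oneMinusX+X zero          = refl
  oneMinusX+X (suc zero)    = refl
  oneMinusX+X (suc (suc _)) = refl

oneMinusX-solves : ∀ {f g} → f ≗ₛ (g +ₛ X ⋆ f) → (oneMinusX ⋆ f) ≗ₛ g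
oneMinusX-solves {f} {g} f≗g+xf =
  +ₛ-cancelʳ {oneMinusX ⋆ f} {g} (X ⋆ f) (≗ₛ-trans (oneMinusX-⋆ f) f≗g+xf)

-- (1 - x)(1 + x) = 1 - x², in the additive form (1-x)(1+x)·f + x²·f = f.
oneMinusX²-⋆ : ∀ f → (((oneMinusX ⋆ onePlusX) ⋆ f) +ₛ X ⋆ (X ⋆ f)) ≗ₛ f
oneMinusX²-⋆ f = +ₛ-cancelʳ {(oneMinusX ⋆ onePlusX) ⋆ f +ₛ X ⋆ (X ⋆ f)} {f} (X ⋆ f) (begin
  ((oneMinusX ⋆ onePlusX) ⋆ f +ₛ X ⋆ (X ⋆ f)) +ₛ X ⋆ f
    ≈⟨ solve 4 (λ a b x f → ((a :* b) :* f :+ x :* (x :* f)) :+ x :* f := a :* (b :* f) :+ x :* (f :+ x :* f))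
         (λ _ → refl) oneMinusX onePlusX X f ⟩
  oneMinusX ⋆ (onePlusX ⋆ f) +ₛ X ⋆ (f +ₛ X ⋆ f)
    ≈⟨ +-cong {oneMinusX ⋆ (onePlusX ⋆ f)} (λ _ → refl) (⋆-congʳ X (≗ₛ-sym (onePlusX-⋆ f))) ⟩
  oneMinusX ⋆ (onePlusX ⋆ f) +ₛ X ⋆ (onePlusX ⋆ f)
    ≈⟨ oneMinusX-⋆ (onePlusX ⋆ f) ⟩
  onePlusX ⋆ f
    ≈⟨ onePlusX-⋆ f ⟩
  f +ₛ X ⋆ f
    ∎) where open ≈-Reasoning

oneMinusX²-solves : ∀ {f g} → f ≗ₛ (g +ₛ X ⋆ (X ⋆ f)) → ((oneMinusX ⋆ onePlusX) ⋆ f) ≗ₛ g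
oneMinusX²-solves {f} {g} f≗g+x²f =
  +ₛ-cancelʳ {(oneMinusX ⋆ onePlusX) ⋆ f} {g} (X ⋆ (X ⋆ f)) (≗ₛ-trans (oneMinusX²-⋆ f) f≗g+x²f)

binomialColumn : ℕ → Series
binomialColumn j n = + (n C j)

oneMinusX⋆binomialColumn₀ : (oneMinusX ⋆ binomialColumn 0) ≗ₛ one
oneMinusX⋆binomialColumn₀ = oneMinusX-solves pascal where
  pascal : binomialColumn 0 ≗ₛ (one +ₛ X ⋆ binomialColumn 0)
  pascal zero    = refl
  pascal (suc n) = sym (trans (ℤP.+-identityˡ _) (X⋆-suc (binomialColumn 0) n))

oneMinusX⋆binomialColumn : ∀ j → (oneMinusX ⋆ binomialColumn (suc j)) ≗ₛ (X ⋆ binomialColumn j)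
oneMinusX⋆binomialColumn j = oneMinusX-solves pascal where
  pascal : binomialColumn (suc j) ≗ₛ (X ⋆ binomialColumn j +ₛ X ⋆ binomialColumn (suc j))
  pascal zero    = refl
  pascal (suc n) = sym (begin
    (X ⋆ binomialColumn j) (suc n) + (X ⋆ binomialColumn (suc j)) (suc n)
      ≡⟨ cong₂ _+_ (X⋆-suc (binomialColumn j) n) (X⋆-suc (binomialColumn (suc j)) n) ⟩
    + (n C j ℕ.+ n C suc j)
      ≡⟨ cong +_ (nCk+nC[k+1]≡[n+1]C[k+1] n j) ⟩
    + (suc n C suc j)
      ∎) where open ≡-Reasoning

oneMinusX^⋆binomialColumn : ∀ j → ((oneMinusX ^ₛ suc j) ⋆ binomialColumn j) ≗ₛ (X ^ₛ j)
oneMinusX^⋆binomialColumn zero = begin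
  (oneMinusX ⋆ one) ⋆ binomialColumn 0
    ≈⟨ solve 2 (λ a g → (a :* con 1) :* g := a :* g) (λ _ → refl) oneMinusX (binomialColumn 0) ⟩
  oneMinusX ⋆ binomialColumn 0
    ≈⟨ oneMinusX⋆binomialColumn₀ ⟩
  one
    ∎ where open ≈-Reasoning
oneMinusX^⋆binomialColumn (suc j) = begin
  (oneMinusX ⋆ Aʲ⁺¹) ⋆ binomialColumn (suc j)
    ≈⟨ solve 3 (λ a p g → (a :* p) :* g := p :* (a :* g)) (λ _ → refl) oneMinusX Aʲ⁺¹ (binomialColumn (suc j)) ⟩
  Aʲ⁺¹ ⋆ (oneMinusX ⋆ binomialColumn (suc j))
    ≈⟨ ⋆-congʳ Aʲ⁺¹ (oneMinusX⋆binomialColumn j) ⟩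
  Aʲ⁺¹ ⋆ (X ⋆ binomialColumn j)
    ≈⟨ solve 3 (λ p x g → p :* (x :* g) := x :* (p :* g)) (λ _ → refl) Aʲ⁺¹ X (binomialColumn j) ⟩
  X ⋆ (Aʲ⁺¹ ⋆ binomialColumn j)
    ≈⟨ ⋆-congʳ X (oneMinusX^⋆binomialColumn j) ⟩
  X ⋆ (X ^ₛ j)
    ∎ where
  open ≈-Reasoning
  Aʲ⁺¹ : Series
  Aʲ⁺¹ = oneMinusX ^ₛ suc j

onePlusX^-coeff : ∀ m j → (onePlusX ^ₛ m) j ≡ + (m C j)
onePlusX^-coeff zero    zero    = refl
onePlusX^-coeff zero    (suc j) = refl
onePlusX^-coeff (suc m) zero    =
  trans (onePlusX-⋆ (onePlusX ^ₛ m) 0) (trans (ℤP.+-identityʳ _) (onePlusX^-coeff m 0))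
onePlusX^-coeff (suc m) (suc j) = begin
  (onePlusX ⋆ (onePlusX ^ₛ m)) (suc j)
    ≡⟨ onePlusX-⋆ (onePlusX ^ₛ m) (suc j) ⟩
  (onePlusX ^ₛ m) (suc j) + (X ⋆ (onePlusX ^ₛ m)) (suc j)
    ≡⟨ cong₂ _+_ (onePlusX^-coeff m (suc j)) (trans (X⋆-suc (onePlusX ^ₛ m) j) (onePlusX^-coeff m j)) ⟩
  + (m C suc j ℕ.+ m C j)
    ≡⟨ cong +_ (trans (ℕP.+-comm (m C suc j) (m C j)) (nCk+nC[k+1]≡[n+1]C[k+1] m j)) ⟩
  + (suc m C suc j)
    ∎ where open ≡-Reasoning

LColumn₀ : LColumn 0 ≗ₛ binomialColumn 0
LColumn₀ n = cong +_ (L-zero n)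

-- Column 1: L(0,1) = 0, L(1,1) = 1 and L(n+2,1) = 1 + L(n,1).
LColumn₁-recurrence : LColumn 1 ≗ₛ (X ⋆ (binomialColumn 0 +ₛ X ⋆ LColumn 1))
LColumn₁-recurrence = ≗ₛ-trans (X⋆tail (LColumn 1) refl) (⋆-congʳ X tail-recurrence) where
  tail-recurrence : tail (LColumn 1) ≗ₛ (binomialColumn 0 +ₛ X ⋆ LColumn 1)
  tail-recurrence zero    = refl
  tail-recurrence (suc n) = trans
    (cong +_ (trans (cong (λ t → L n (+ 1) ℕ.+ 1 ℕ.+ t) (L-negative n 0)) (shuffle (L n (+ 1)))))
    (cong (λ t → + 1 + t) (sym (X⋆-suc (LColumn 1) n)))
    where
    shuffle : ∀ a → a ℕ.+ 1 ℕ.+ 0 ≡ 1 ℕ.+ a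
    shuffle = ℕSolver.solve-∀

-- Columns k+2: L(0,k+2) = L(1,k+2) = 0 and the defining recurrence
-- L(n+2,k+2) = L(n,k+2) + C(n,k+1) + L(n,k).
LColumn-recurrence : ∀ k → LColumn (suc (suc k)) ≗ₛ
  (X ⋆ (X ⋆ (binomialColumn (suc k) +ₛ LColumn k +ₛ LColumn (suc (suc k)))))
LColumn-recurrence k = ≗ₛ-trans (X⋆tail F refl) (⋆-congʳ X (≗ₛ-trans (X⋆tail (tail F) refl) (⋆-congʳ X recurrence)))
  where
  F : Series
  F = LColumn (suc (suc k))
  recurrence : tail (tail F) ≗ₛ (binomialColumn (suc k) +ₛ LColumn k +ₛ F)
  recurrence n = cong +_ (rotate (L n (+ suc (suc k))) (n C suc k) (L n (+ k)))
    where
    rotate : ∀ a b c → a ℕ.+ b ℕ.+ c ≡ b ℕ.+ c ℕ.+ a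
    rotate = ℕSolver.solve-∀

eSeries : ℕ → Series
eSeries k j = + e k j

-- e_k(x) is a polynomial of degree ≤ k, so its truncation changes nothing.
ePoly≗eSeries : ∀ k → ePoly k ≗ₛ eSeries k
ePoly≗eSeries k j with j ℕP.≤? k
... | yes _   = refl
... | no  j≰k = cong +_ (sym (e-above (ℕP.≰⇒> j≰k)))

numer≗Xpow⋆eSeries : ∀ k → numer k ≗ₛ ((X ^ₛ k) ⋆ eSeries k)
numer≗Xpow⋆eSeries k = ≗ₛ-trans (shift≗Xpow⋆ k (ePoly k)) (⋆-congʳ (X ^ₛ k) (ePoly≗eSeries k))

eSeries-recurrence : ∀ k →
  (eSeries (suc (suc k)) +ₛ X ⋆ (X ⋆ eSeries k)) ≗ₛ (X ⋆ (onePlusX ^ₛ suc k) +ₛ eSeries k)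
eSeries-recurrence k zero = cong +_ (trans (ℕP.+-identityʳ _) (trans (e-zero (suc (suc k))) (sym (e-zero k))))
eSeries-recurrence k (suc zero) = begin
  + e (suc (suc k)) 1 + (X ⋆ (X ⋆ eSeries k)) 1
    ≡⟨ cong (λ t → + e (suc (suc k)) 1 + t) (X⋆-suc (X ⋆ eSeries k) 0) ⟩
  + (e (suc (suc k)) 1 ℕ.+ 0)
    ≡⟨ cong +_ (trans (ℕP.+-identityʳ _) (e-recurrence₁ k)) ⟩
  + (suc k C 0) + + e k 1
    ≡⟨ cong (λ t → t + + e k 1) (trans (sym (onePlusX^-coeff (suc k) 0)) (sym (X⋆-suc (onePlusX ^ₛ suc k) 0))) ⟩
  (X ⋆ (onePlusX ^ₛ suc k)) 1 + + e k 1
    ∎ where open ≡-Reasoning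
eSeries-recurrence k (suc (suc m)) = begin
  + e (suc (suc k)) (suc (suc m)) + (X ⋆ (X ⋆ eSeries k)) (suc (suc m))
    ≡⟨ cong (λ t → + e (suc (suc k)) (suc (suc m)) + t) (trans (X⋆-suc (X ⋆ eSeries k) (suc m)) (X⋆-suc (eSeries k) m)) ⟩
  + (e (suc (suc k)) (suc (suc m)) ℕ.+ e k m)
    ≡⟨ cong +_ (e-recurrence k m) ⟩
  + (suc k C suc m) + + e k (suc (suc m))
    ≡⟨ cong (λ t → t + + e k (suc (suc m)))
         (trans (sym (onePlusX^-coeff (suc k) (suc m))) (sym (X⋆-suc (onePlusX ^ₛ suc k) (suc m)))) ⟩
  (X ⋆ (onePlusX ^ₛ suc k)) (suc (suc m)) + + e k (suc (suc m))
    ∎ where open ≡-Reasoning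

eSeries-step : ∀ k → ((oneMinusX ⋆ onePlusX) ⋆ eSeries k +ₛ X ⋆ (onePlusX ^ₛ suc k)) ≗ₛ eSeries (suc (suc k))
eSeries-step k = +ₛ-cancelʳ {W ⋆ eₖ +ₛ X ⋆ Bᵏ⁺¹} {eSeries (suc (suc k))} (X ⋆ (X ⋆ eₖ)) (begin
  (W ⋆ eₖ +ₛ X ⋆ Bᵏ⁺¹) +ₛ X ⋆ (X ⋆ eₖ)
    ≈⟨ solve 4 (λ w e x b → (w :* e :+ x :* b) :+ x :* (x :* e) := (w :* e :+ x :* (x :* e)) :+ x :* b)
         (λ _ → refl) W eₖ X Bᵏ⁺¹ ⟩
  (W ⋆ eₖ +ₛ X ⋆ (X ⋆ eₖ)) +ₛ X ⋆ Bᵏ⁺¹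
    ≈⟨ +-cong {W ⋆ eₖ +ₛ X ⋆ (X ⋆ eₖ)} {eₖ} {X ⋆ Bᵏ⁺¹} {X ⋆ Bᵏ⁺¹} (oneMinusX²-⋆ eₖ) (λ _ → refl) ⟩
  eₖ +ₛ X ⋆ Bᵏ⁺¹
    ≈⟨ solve 2 (λ e xb → e :+ xb := xb :+ e) (λ _ → refl) eₖ (X ⋆ Bᵏ⁺¹) ⟩
  X ⋆ Bᵏ⁺¹ +ₛ eₖ
    ≈⟨ ≗ₛ-sym (eSeries-recurrence k) ⟩
  eSeries (suc (suc k)) +ₛ X ⋆ (X ⋆ eₖ)
    ∎) where
  open ≈-Reasoning
  W eₖ Bᵏ⁺¹ : Series
  W = oneMinusX ⋆ onePlusX
  eₖ = eSeries k
  Bᵏ⁺¹ = onePlusX ^ₛ suc k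

oneMinusX²⋆LColumn₁ : ((oneMinusX ⋆ onePlusX) ⋆ LColumn 1) ≗ₛ (X ⋆ binomialColumn 0)
oneMinusX²⋆LColumn₁ = oneMinusX²-solves (≗ₛ-trans LColumn₁-recurrence
  (solve 3 (λ x g f → x :* (g :+ x :* f) := x :* g :+ x :* (x :* f))
     (λ _ → refl) X (binomialColumn 0) (LColumn 1)))

oneMinusX²⋆LColumn : ∀ k →
  ((oneMinusX ⋆ onePlusX) ⋆ LColumn (suc (suc k))) ≗ₛ (X ⋆ (X ⋆ (binomialColumn (suc k) +ₛ LColumn k)))
oneMinusX²⋆LColumn k = oneMinusX²-solves (≗ₛ-trans (LColumn-recurrence k)
  (solve 4 (λ x g f h → x :* (x :* (g :+ f :+ h)) := x :* (x :* (g :+ f)) :+ x :* (x :* h))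
     (λ _ → refl) X (binomialColumn (suc k)) (LColumn k) (LColumn (suc (suc k)))))

ColumnGF : ℕ → Set
ColumnGF k = (denom k ⋆ LColumn k) ≗ₛ ((X ^ₛ k) ⋆ eSeries k)

-- Base cases: denom 0 = 1-x, denom 1 = (1-x)²(1+x), e₀(x) = e₁(x) = 1.
columnGF₀ : ColumnGF 0
columnGF₀ = begin
  ((oneMinusX ⋆ one) ⋆ one) ⋆ LColumn 0
    ≈⟨ solve 2 (λ a f → ((a :* con 1) :* con 1) :* f := a :* f) (λ _ → refl) oneMinusX (LColumn 0) ⟩
  oneMinusX ⋆ LColumn 0
    ≈⟨ ⋆-congʳ oneMinusX LColumn₀ ⟩
  oneMinusX ⋆ binomialColumn 0
    ≈⟨ oneMinusX⋆binomialColumn₀ ⟩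
  one
    ≈⟨ solve 1 (λ e → e := con 1 :* e) (λ _ → refl) one ⟩
  one ⋆ one
    ≈⟨ ⋆-congʳ one e₀≗one ⟨
  one ⋆ eSeries 0
    ∎ where
  open ≈-Reasoning
  e₀≗one : eSeries 0 ≗ₛ one
  e₀≗one zero    = refl
  e₀≗one (suc _) = refl

columnGF₁ : ColumnGF 1
columnGF₁ = begin
  ((oneMinusX ⋆ (oneMinusX ⋆ one)) ⋆ (onePlusX ⋆ one)) ⋆ LColumn 1
    ≈⟨ solve 3 (λ a b f → (a :* (a :* con 1)) :* (b :* con 1) :* f := a :* ((a :* b) :* f))
         (λ _ → refl) oneMinusX onePlusX (LColumn 1) ⟩
  oneMinusX ⋆ ((oneMinusX ⋆ onePlusX) ⋆ LColumn 1)
    ≈⟨ ⋆-congʳ oneMinusX oneMinusX²⋆LColumn₁ ⟩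
  oneMinusX ⋆ (X ⋆ binomialColumn 0)
    ≈⟨ solve 3 (λ a x g → a :* (x :* g) := x :* (a :* g)) (λ _ → refl) oneMinusX X (binomialColumn 0) ⟩
  X ⋆ (oneMinusX ⋆ binomialColumn 0)
    ≈⟨ ⋆-congʳ X oneMinusX⋆binomialColumn₀ ⟩
  X ⋆ one
    ≈⟨ solve 1 (λ x → x :* con 1 := (x :* con 1) :* con 1) (λ _ → refl) X ⟩
  (X ⋆ one) ⋆ one
    ≈⟨ ⋆-congʳ (X ⋆ one) e₁≗one ⟨
  (X ⋆ one) ⋆ eSeries 1
    ∎ where
  open ≈-Reasoning
  e₁≗one : eSeries 1 ≗ₛ one
  e₁≗one zero          = refl
  e₁≗one (suc zero)    = refl
  e₁≗one (suc (suc _)) = refl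

-- From column k to column k+2: denom (k+2) = (1-x²)² · denom k.
columnGF-step : ∀ k → ColumnGF k → ColumnGF (suc (suc k))
columnGF-step k gfₖ = begin
  ((oneMinusX ⋆ (oneMinusX ⋆ Aᵏ⁺¹)) ⋆ (onePlusX ⋆ (onePlusX ⋆ Bᵏ))) ⋆ Fₖ₊₂
    ≈⟨ solve 5 (λ a b p q f → ((a :* (a :* p)) :* (b :* (b :* q))) :* f := ((a :* b) :* (p :* q)) :* ((a :* b) :* f))
         (λ _ → refl) oneMinusX onePlusX Aᵏ⁺¹ Bᵏ Fₖ₊₂ ⟩
  (W ⋆ denom k) ⋆ (W ⋆ Fₖ₊₂)
    ≈⟨ ⋆-congʳ (W ⋆ denom k) (oneMinusX²⋆LColumn k) ⟩
  (W ⋆ denom k) ⋆ (X ⋆ (X ⋆ (G +ₛ Fₖ)))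
    ≈⟨ solve 7 (λ a b p q x g f → ((a :* b) :* (p :* q)) :* (x :* (x :* (g :+ f)))
                                  := x :* (x :* ((b :* q) :* ((a :* p) :* g) :+ (a :* b) :* ((p :* q) :* f))))
         (λ _ → refl) oneMinusX onePlusX Aᵏ⁺¹ Bᵏ X G Fₖ ⟩
  X ⋆ (X ⋆ (Bᵏ⁺¹ ⋆ ((oneMinusX ^ₛ suc (suc k)) ⋆ G) +ₛ W ⋆ (denom k ⋆ Fₖ)))
    ≈⟨ ⋆-congʳ X (⋆-congʳ X (+-cong {Bᵏ⁺¹ ⋆ ((oneMinusX ^ₛ suc (suc k)) ⋆ G)} {Bᵏ⁺¹ ⋆ (X ^ₛ suc k)}
         (⋆-congʳ Bᵏ⁺¹ (oneMinusX^⋆binomialColumn (suc k))) (⋆-congʳ W gfₖ))) ⟩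
  X ⋆ (X ⋆ (Bᵏ⁺¹ ⋆ (X ⋆ Xᵏ) +ₛ W ⋆ (Xᵏ ⋆ eSeries k)))
    ≈⟨ solve 5 (λ x xk b w e → x :* (x :* (b :* (x :* xk) :+ w :* (xk :* e)))
                               := (x :* (x :* xk)) :* (w :* e :+ x :* b))
         (λ _ → refl) X Xᵏ Bᵏ⁺¹ W (eSeries k) ⟩
  (X ^ₛ suc (suc k)) ⋆ (W ⋆ eSeries k +ₛ X ⋆ Bᵏ⁺¹)
    ≈⟨ ⋆-congʳ (X ^ₛ suc (suc k)) (eSeries-step k) ⟩
  (X ^ₛ suc (suc k)) ⋆ eSeries (suc (suc k))
    ∎ where
  open ≈-Reasoning
  W Aᵏ⁺¹ Bᵏ Bᵏ⁺¹ Xᵏ G Fₖ Fₖ₊₂ : Series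
  W = oneMinusX ⋆ onePlusX
  Aᵏ⁺¹ = oneMinusX ^ₛ suc k
  Bᵏ = onePlusX ^ₛ k
  Bᵏ⁺¹ = onePlusX ^ₛ suc k
  Xᵏ = X ^ₛ k
  G = binomialColumn (suc k)
  Fₖ = LColumn k
  Fₖ₊₂ = LColumn (suc (suc k))

columnGF : ∀ k → ColumnGF k
columnGF zero          = columnGF₀
columnGF (suc zero)    = columnGF₁
columnGF (suc (suc k)) = columnGF-step k (columnGF k)

LColumn≗LDiagonal : ∀ k → LColumn k ≗ₛ LDiagonal k
LColumn≗LDiagonal k n = cong +_ (L-symmetric n (+ k))

proposition3p3 : (k : ℕ) →
    (LColumn k ≗ₛ LDiagonal k)
    × ((denom k ⋆ LColumn k) ≗ₛ numer k)
    × ((denom k ⋆ LDiagonal k) ≗ₛ numer k)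
proposition3p3 k = LColumn≗LDiagonal k , columnIdentity , diagonalIdentity
  where
  columnIdentity : (denom k ⋆ LColumn k) ≗ₛ numer k
  columnIdentity = ≗ₛ-trans (columnGF k) (≗ₛ-sym (numer≗Xpow⋆eSeries k))
  diagonalIdentity : (denom k ⋆ LDiagonal k) ≗ₛ numer k
  diagonalIdentity = ≗ₛ-trans (⋆-congʳ (denom k) (≗ₛ-sym (LColumn≗LDiagonal k))) columnIdentity
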